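{- The map $\omega\mapsto\mathrm{PS}_\omega$ from the set $S_n^m$ of finite $m$-stable permutations to $\mathrm{PF}_{m/n}$ is injective.
   Context: Let $m,n$ be positive integers. A permutation $\omega\in S_n$ of $\{1,\dots,n\}$ is called finite $m$-stable if $\omega(x+m)>\omega(x)$ for all $1\le x\le n-m$; $S_n^m$ denotes the set of these. For $\omega\in S_n^m$ and $\alpha\in\{1,\dots,n\}$, $\mathrm{PS}_\omega(\alpha)$ is the number of pairs $(x,y)$ with $1\le x<y<x+m$, $y\le n$, and $\omega(x)>\omega(y)=\alpha$ (inversions of height less than $m$ ending at value $\alpha$). $\mathrm{PF}_{m/n}$ is the set of $f:\{1,\dots,n\}\to\mathbb{Z}_{\ge0}$ with $\sharp\{k: f(k)\le \frac{im}{n}\}\ge i+1$ for all $i\in\{0,\dots,n-1\}$; the values $\mathrm{PS}_\omega$ lie in this set. -}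

module Defs where

open import Data.Nat using (ℕ; _+_; _*_; _≤_; _<_; _≤?_; _<?_)
open import Data.Fin using (Fin; toℕ)
import Data.Fin as Fin
open import Data.Fin.Permutation using (Permutation′; _⟨$⟩ʳ_)
open import Data.List using (List; length; filter; allFin; cartesianProduct)
open import Data.Product using (_×_; _,_; proj₁; proj₂)
open import Relation.Nullary.Decidable using (_×-dec_)
open import Relation.Binary.PropositionalEquality using (_≡_)

-- Convention: {1,…,n} is represented by Fin n, element x ∈ Fin n standing
-- for toℕ x + 1 (both for positions and for values).

IsStable : (m n : ℕ) → Permutation′ n → Set
IsStable m n ω = (x y : Fin n) → toℕ y ≡ toℕ x + m →
  toℕ (ω ⟨$⟩ʳ x) < toℕ (ω ⟨$⟩ʳ y)

PSPair : (m n : ℕ) → Permutation′ n → Fin n → Fin n × Fin n → Set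
PSPair m n ω α (x , y) =
  toℕ x < toℕ y × toℕ y < toℕ x + m ×
  toℕ (ω ⟨$⟩ʳ y) < toℕ (ω ⟨$⟩ʳ x) × ω ⟨$⟩ʳ y ≡ α

PSPair? : (m n : ℕ) (ω : Permutation′ n) (α : Fin n) →
  (p : Fin n × Fin n) → Relation.Nullary.Decidable.Dec (PSPair m n ω α p)
PSPair? m n ω α (x , y) =
  (toℕ x <? toℕ y) ×-dec (toℕ y <? toℕ x + m) ×-dec
  (toℕ (ω ⟨$⟩ʳ y) <? toℕ (ω ⟨$⟩ʳ x)) ×-dec (ω ⟨$⟩ʳ y Fin.≟ α)

PS : (m n : ℕ) → Permutation′ n → Fin n → ℕ
PS m n ω α = length (filter (PSPair? m n ω α) (cartesianProduct (allFin n) (allFin n)))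

-- PF_{m/n} (for reference): f with #{k : f(k) ≤ i m / n} ≥ i+1 for i < n,
-- i.e. #{k : n * f(k) ≤ i * m} ≥ i + 1.
IsPF : (m n : ℕ) → (Fin n → ℕ) → Set
IsPF m n f = (i : Fin n) →
  toℕ i + 1 ≤ length (filter (λ k → n * f k ≤? toℕ i * m) (allFin n))

-- Induction on the value α.  Suppose ω and ω′ agree at every position whose value is below α,
-- and α sits at position y under ω and at a later position y′ under ω′.  The positions x with
-- (x , y) an inversion of ω ending at α, together with y itself, lie in the window (y - m , y]
-- and carry values ≥ α.  Sliding each of them by a multiple of m into the window (y′ - m , y′]
-- gives, by m-stability of ω′, an inversion of ω′ ending at α; positions of a window of width
-- m have distinct residues mod m, so this is injective and PS ω′ α > PS ω α.  Hence equal PS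
-- forces y = y′.
module Submission where

open import Defs
open import Data.Nat using (ℕ; zero; suc; _+_; _*_; _∸_; _≤_; _<_; NonZero; >-nonZero⁻¹)
open import Data.Nat.Properties
open import Data.Nat.DivMod using (_%_; _/_; m≡m%n+[m/n]*n; [m+kn]%n≡m%n; m*n%n≡0; m%n<n; m%n≤m; m<n⇒m%n≡m)
open import Data.Fin using (Fin; toℕ; fromℕ<)
import Data.Fin as Fin
open import Data.Fin.Properties using (toℕ-injective; toℕ<n; toℕ-fromℕ<; injective⇒≤)
open import Data.Fin.Induction using (<-wellFounded)
open import Data.Fin.Permutation using (Permutation′; _⟨$⟩ʳ_; _⟨$⟩ˡ_; inverseˡ; inverseʳ)
open import Data.List using (List; _∷_; length; lookup; filter; allFin; cartesianProduct)
open import Data.List.Membership.Propositional using (_∈_)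
open import Data.List.Membership.Propositional.Properties
  using (∈-lookup; ∈-filter⁺; ∈-filter⁻; ∈-cartesianProduct⁺; ∈-allFin)
open import Data.List.Membership.Setoid.Properties using (index-injective)
open import Data.List.Relation.Unary.Any using (here; there; index)
import Data.List.Relation.Unary.All as All
open import Data.List.Relation.Unary.AllPairs using (_∷_)
open import Data.List.Relation.Unary.All.Properties using (all-filter)
open import Data.List.Relation.Unary.Unique.Propositional using (Unique)
open import Data.List.Relation.Unary.Unique.Propositional.Properties
  using (allFin⁺; cartesianProduct⁺; filter⁺)
open import Data.Product using (_×_; _,_; proj₁; proj₂)
open import Data.Sum using (inj₁; inj₂)
open import Function.Base using (_∘_)
open import Function.Definitions using (Injective)
import Induction.WellFounded as WF
open import Relation.Binary using (tri<; tri≈; tri>)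
open import Relation.Binary.PropositionalEquality
  using (_≡_; refl; sym; trans; cong; cong₂; subst; setoid; module ≡-Reasoning)
open import Relation.Nullary using (contradiction)

module _ {A B : Set} where

  Unique⇒lookup-injective : ∀ {xs : List A} → Unique xs → Injective _≡_ _≡_ (lookup xs)
  Unique⇒lookup-injective {_ ∷ _} _ {Fin.zero} {Fin.zero} _ = refl
  Unique⇒lookup-injective {_ ∷ _} (x∉ ∷ _) {Fin.zero} {Fin.suc j} eq =
    contradiction eq (All.lookup x∉ (∈-lookup j))
  Unique⇒lookup-injective {_ ∷ _} (x∉ ∷ _) {Fin.suc i} {Fin.zero} eq =
    contradiction (sym eq) (All.lookup x∉ (∈-lookup i))
  Unique⇒lookup-injective {_ ∷ _} (_ ∷ u) {Fin.suc i} {Fin.suc j} eq =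
    cong Fin.suc (Unique⇒lookup-injective u eq)

  length-≤-by-injection : ∀ {xs : List A} {ys : List B} (f : A → B) → Unique xs →
    (∀ {a} → a ∈ xs → f a ∈ ys) →
    (∀ {a b} → a ∈ xs → b ∈ xs → f a ≡ f b → a ≡ b) →
    length xs ≤ length ys
  length-≤-by-injection f unique into injective = injective⇒≤ lookup-into-injective
    where
    lookup-into-injective : ∀ {i j} → index (into (∈-lookup i)) ≡ index (into (∈-lookup j)) → i ≡ j
    lookup-into-injective {i} {j} eq = Unique⇒lookup-injective unique (injective (∈-lookup i) (∈-lookup j)
      (index-injective (setoid B) (into (∈-lookup i)) (into (∈-lookup j)) eq))

module _ (m : ℕ) .{{_ : NonZero m}} where

  +-*-cancel-in-window : ∀ {a b} p q → a ≤ b → b < a + m → a + p * m ≡ b + q * m → a ≡ b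
  +-*-cancel-in-window {a} {b} p q a≤b b<a+m eq = begin
    a           ≡⟨ +-identityʳ a ⟨
    a + 0       ≡⟨ cong (a +_) d≡0 ⟨
    a + (b ∸ a) ≡⟨ m+[n∸m]≡n a≤b ⟩
    b           ∎
    where
    open ≡-Reasoning
    d : ℕ
    d = b ∸ a
    p*m≡d+q*m : p * m ≡ d + q * m
    p*m≡d+q*m = +-cancelˡ-≡ a _ _ (begin
      a + p * m       ≡⟨ eq ⟩
      b + q * m       ≡⟨ cong (_+ q * m) (m+[n∸m]≡n a≤b) ⟨
      a + d + q * m   ≡⟨ +-assoc a d (q * m) ⟩
      a + (d + q * m) ∎)
    d≡0 : d ≡ 0
    d≡0 = begin
      d               ≡⟨ m<n⇒m%n≡m (m<n+o⇒m∸n<o b a b<a+m) ⟨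
      d % m           ≡⟨ [m+kn]%n≡m%n d q m ⟨
      (d + q * m) % m ≡⟨ cong (_% m) p*m≡d+q*m ⟨
      (p * m) % m     ≡⟨ m*n%n≡0 p m ⟩
      0               ∎

  -- the largest number ≤ t congruent to x modulo m (when x ≤ t)
  slideUpTo : ℕ → ℕ → ℕ
  slideUpTo t x = t ∸ (t ∸ x) % m

  slideUpTo≤ : ∀ t x → slideUpTo t x ≤ t
  slideUpTo≤ t x = m∸n≤m t ((t ∸ x) % m)

  slideUpTo≡+* : ∀ {t x} → x ≤ t → slideUpTo t x ≡ x + (t ∸ x) / m * m
  slideUpTo≡+* {t} {x} x≤t = begin
    t ∸ r                 ≡⟨ cong (_∸ r) t≡x+q*m+r ⟩
    (x + q * m) + r ∸ r   ≡⟨ m+n∸n≡m (x + q * m) r ⟩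
    x + q * m             ∎
    where
    open ≡-Reasoning
    r q : ℕ
    r = (t ∸ x) % m
    q = (t ∸ x) / m
    t≡x+q*m+r : t ≡ x + q * m + r
    t≡x+q*m+r = begin
      t               ≡⟨ m+[n∸m]≡n x≤t ⟨
      x + (t ∸ x)     ≡⟨ cong (x +_) (m≡m%n+[m/n]*n (t ∸ x) m) ⟩
      x + (r + q * m) ≡⟨ cong (x +_) (+-comm r (q * m)) ⟩
      x + (q * m + r) ≡⟨ +-assoc x (q * m) r ⟨
      x + q * m + r   ∎

  <slideUpTo+m : ∀ t x → t < slideUpTo t x + m
  <slideUpTo+m t x = begin-strict
    t                 ≡⟨ m∸n+n≡m r≤t ⟨
    slideUpTo t x + r <⟨ +-monoʳ-< (slideUpTo t x) (m%n<n (t ∸ x) m) ⟩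
    slideUpTo t x + m ∎
    where
    open ≤-Reasoning
    r : ℕ
    r = (t ∸ x) % m
    r≤t : r ≤ t
    r≤t = ≤-trans (m%n≤m (t ∸ x) m) (m∸n≤m t x)

stable⇒mono-+* : ∀ {m n} {ω : Permutation′ n} → IsStable m n ω →
  ∀ q {x z : Fin n} → toℕ z ≡ toℕ x + q * m → toℕ (ω ⟨$⟩ʳ x) ≤ toℕ (ω ⟨$⟩ʳ z)
stable⇒mono-+* {ω = ω} _ zero {x} {z} z≡x+0 =
  ≤-reflexive (cong (λ w → toℕ (ω ⟨$⟩ʳ w)) x≡z)
  where
  x≡z : x ≡ z
  x≡z = toℕ-injective (trans (sym (+-identityʳ (toℕ x))) (sym z≡x+0))
stable⇒mono-+* {m} {n} {ω} stable (suc q) {x} {z} z≡x+m+q*m =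
  <⇒≤ (<-≤-trans (stable x w w≡x+m) (stable⇒mono-+* {m} {ω = ω} stable q z≡w+q*m))
  where
  z≡[x+m]+q*m : toℕ z ≡ (toℕ x + m) + q * m
  z≡[x+m]+q*m = trans z≡x+m+q*m (sym (+-assoc (toℕ x) m (q * m)))
  x+m<n : toℕ x + m < n
  x+m<n = ≤-<-trans (m≤m+n (toℕ x + m) (q * m)) (subst (_< n) z≡[x+m]+q*m (toℕ<n z))
  w : Fin n
  w = fromℕ< x+m<n
  w≡x+m : toℕ w ≡ toℕ x + m
  w≡x+m = toℕ-fromℕ< x+m<n
  z≡w+q*m : toℕ z ≡ toℕ w + q * m
  z≡w+q*m = trans z≡[x+m]+q*m (cong (_+ q * m) (sym w≡x+m))

⟨$⟩ˡ-agree⇒⟨$⟩ʳ-agree : ∀ {n} (ω ω′ : Permutation′ n) (x : Fin n) →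
  ω ⟨$⟩ˡ (ω′ ⟨$⟩ʳ x) ≡ ω′ ⟨$⟩ˡ (ω′ ⟨$⟩ʳ x) → ω ⟨$⟩ʳ x ≡ ω′ ⟨$⟩ʳ x
⟨$⟩ˡ-agree⇒⟨$⟩ʳ-agree ω ω′ x eq = begin
  ω ⟨$⟩ʳ x                        ≡⟨ cong (ω ⟨$⟩ʳ_) (inverseˡ ω′) ⟨
  ω ⟨$⟩ʳ (ω′ ⟨$⟩ˡ (ω′ ⟨$⟩ʳ x))    ≡⟨ cong (ω ⟨$⟩ʳ_) eq ⟨
  ω ⟨$⟩ʳ (ω ⟨$⟩ˡ (ω′ ⟨$⟩ʳ x))     ≡⟨ inverseʳ ω ⟩
  ω′ ⟨$⟩ʳ x                       ∎
  where open ≡-Reasoning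

module _ {m n : ℕ} .{{_ : NonZero m}} (ω ω′ : Permutation′ n) (α : Fin n)
  (stable′ : IsStable m n ω′)
  (agree-below-α : ∀ x → toℕ (ω′ ⟨$⟩ʳ x) < toℕ α → ω ⟨$⟩ʳ x ≡ ω′ ⟨$⟩ʳ x)
  (y<y′ : toℕ (ω ⟨$⟩ˡ α) < toℕ (ω′ ⟨$⟩ˡ α))
  where

  private
    y y′ : Fin n
    y = ω ⟨$⟩ˡ α
    y′ = ω′ ⟨$⟩ˡ α

    above-α : ∀ x → toℕ α ≤ toℕ (ω ⟨$⟩ʳ x) → toℕ x < toℕ y′ → toℕ α < toℕ (ω′ ⟨$⟩ʳ x)
    above-α x α≤ωx x<y′ with <-cmp (toℕ (ω′ ⟨$⟩ʳ x)) (toℕ α)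
    ... | tri< ω′x<α _ _ =
      contradiction (subst (λ v → toℕ v < toℕ α) (sym (agree-below-α x ω′x<α)) ω′x<α) (≤⇒≯ α≤ωx)
    ... | tri≈ _ ω′x≡α _ = contradiction (cong toℕ x≡y′) (<⇒≢ x<y′)
      where
      x≡y′ : x ≡ y′
      x≡y′ = trans (sym (inverseˡ ω′)) (cong (ω′ ⟨$⟩ˡ_) (toℕ-injective ω′x≡α))
    ... | tri> _ _ α<ω′x = α<ω′x

    InWindow : Fin n → Set
    InWindow x = toℕ x ≤ toℕ y × toℕ y < toℕ x + m × toℕ α ≤ toℕ (ω ⟨$⟩ʳ x)

    inversion⇒InWindow : ∀ {x z} → PSPair m n ω α (x , z) → z ≡ y × InWindow x
    inversion⇒InWindow {x} {z} (x<z , z<x+m , ωz<ωx , ωz≡α) =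
      z≡y ,
      subst (λ v → toℕ x ≤ toℕ v) z≡y (<⇒≤ x<z) ,
      subst (λ v → toℕ v < toℕ x + m) z≡y z<x+m ,
      <⇒≤ (subst (λ v → toℕ v < toℕ (ω ⟨$⟩ʳ x)) ωz≡α ωz<ωx)
      where
      z≡y : z ≡ y
      z≡y = trans (sym (inverseˡ ω)) (cong (ω ⟨$⟩ˡ_) ωz≡α)

    y-InWindow : InWindow y
    y-InWindow = ≤-refl , m<m+n (toℕ y) (>-nonZero⁻¹ m) , ≤-reflexive (cong toℕ (sym (inverseʳ ω)))

    slide : Fin n → Fin n
    slide x = fromℕ< (≤-<-trans (slideUpTo≤ m (toℕ y′) (toℕ x)) (toℕ<n y′))

    toℕ-slide : ∀ x → toℕ (slide x) ≡ slideUpTo m (toℕ y′) (toℕ x)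
    toℕ-slide x = toℕ-fromℕ< _

    InWindow⇒< : ∀ {x} → InWindow x → toℕ x < toℕ y′
    InWindow⇒< (x≤y , _) = ≤-<-trans x≤y y<y′

    slides : Fin n → ℕ
    slides x = (toℕ y′ ∸ toℕ x) / m

    toℕ-slide≡+* : ∀ {x} → InWindow x → toℕ (slide x) ≡ toℕ x + slides x * m
    toℕ-slide≡+* {x} w = trans (toℕ-slide x) (slideUpTo≡+* m (<⇒≤ (InWindow⇒< w)))

    slide-inversion : ∀ {x} → InWindow x → PSPair m n ω′ α (slide x , y′)
    slide-inversion {x} w@(_ , _ , α≤ωx) =
      ≤∧≢⇒< slide≤y′ (λ eq → <⇒≢ α<ω′[slide] (sym (cong toℕ (ω′[slide]≡α eq)))) ,
      subst (λ v → toℕ y′ < v + m) (sym (toℕ-slide x)) (<slideUpTo+m m (toℕ y′) (toℕ x)) ,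
      subst (λ v → toℕ v < toℕ (ω′ ⟨$⟩ʳ slide x)) (sym ω′y′≡α) α<ω′[slide] ,
      ω′y′≡α
      where
      ω′y′≡α : ω′ ⟨$⟩ʳ y′ ≡ α
      ω′y′≡α = inverseʳ ω′
      α<ω′[slide] : toℕ α < toℕ (ω′ ⟨$⟩ʳ slide x)
      α<ω′[slide] = <-≤-trans (above-α x α≤ωx (InWindow⇒< w))
                              (stable⇒mono-+* {m} {ω = ω′} stable′ (slides x) (toℕ-slide≡+* w))
      slide≤y′ : toℕ (slide x) ≤ toℕ y′
      slide≤y′ = subst (_≤ toℕ y′) (sym (toℕ-slide x)) (slideUpTo≤ m (toℕ y′) (toℕ x))
      ω′[slide]≡α : toℕ (slide x) ≡ toℕ y′ → ω′ ⟨$⟩ʳ slide x ≡ α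
      ω′[slide]≡α eq = trans (cong (ω′ ⟨$⟩ʳ_) (toℕ-injective eq)) ω′y′≡α

    slide-injective-≤ : ∀ {x₁ x₂} → InWindow x₁ → InWindow x₂ → toℕ x₁ ≤ toℕ x₂ →
      slide x₁ ≡ slide x₂ → x₁ ≡ x₂
    slide-injective-≤ {x₁} {x₂} w₁@(_ , y<x₁+m , _) w₂@(x₂≤y , _ , _) x₁≤x₂ eq =
      toℕ-injective (+-*-cancel-in-window m (slides x₁) (slides x₂) x₁≤x₂ (≤-<-trans x₂≤y y<x₁+m)
        (trans (sym (toℕ-slide≡+* w₁)) (trans (cong toℕ eq) (toℕ-slide≡+* w₂))))

    slide-injective : ∀ {x₁ x₂} → InWindow x₁ → InWindow x₂ → slide x₁ ≡ slide x₂ → x₁ ≡ x₂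
    slide-injective {x₁} {x₂} w₁ w₂ eq with ≤-total (toℕ x₁) (toℕ x₂)
    ... | inj₁ x₁≤x₂ = slide-injective-≤ w₁ w₂ x₁≤x₂ eq
    ... | inj₂ x₂≤x₁ = sym (slide-injective-≤ w₂ w₁ x₂≤x₁ (sym eq))

    allPairs : List (Fin n × Fin n)
    allPairs = cartesianProduct (allFin n) (allFin n)

    inversionsAt : Permutation′ n → List (Fin n × Fin n)
    inversionsAt σ = filter (PSPair? m n σ α) allPairs

    -- (y , y) is no inversion; it is the extra source that makes the count strictly larger.
    sources : List (Fin n × Fin n)
    sources = (y , y) ∷ inversionsAt ω

    sources-unique : Unique sources
    sources-unique =
      All.map (λ { {x , _} (x<y , _) refl → <-irrefl refl x<y }) (all-filter (PSPair? m n ω α) allPairs) ∷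
      filter⁺ (PSPair? m n ω α) (cartesianProduct⁺ (allFin⁺ n) (allFin⁺ n))

    ∈sources⇒InWindow : ∀ {p} → p ∈ sources → proj₂ p ≡ y × InWindow (proj₁ p)
    ∈sources⇒InWindow (here refl) = refl , y-InWindow
    ∈sources⇒InWindow (there p∈) =
      inversion⇒InWindow (proj₂ (∈-filter⁻ (PSPair? m n ω α) {xs = allPairs} p∈))

    slidePair : Fin n × Fin n → Fin n × Fin n
    slidePair (x , _) = slide x , y′

  position<⇒PS< : PS m n ω α < PS m n ω′ α
  position<⇒PS< = length-≤-by-injection slidePair sources-unique into injective
    where
    into : ∀ {p} → p ∈ sources → slidePair p ∈ inversionsAt ω′
    into p∈ = ∈-filter⁺ (PSPair? m n ω′ α) (∈-cartesianProduct⁺ (∈-allFin _) (∈-allFin _))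
                (slide-inversion (proj₂ (∈sources⇒InWindow p∈)))
    injective : ∀ {p₁ p₂} → p₁ ∈ sources → p₂ ∈ sources → slidePair p₁ ≡ slidePair p₂ → p₁ ≡ p₂
    injective p₁∈ p₂∈ eq with ∈sources⇒InWindow p₁∈ | ∈sources⇒InWindow p₂∈
    ... | z₁≡y , w₁ | z₂≡y , w₂ =
      cong₂ _,_ (slide-injective w₁ w₂ (cong proj₁ eq)) (trans z₁≡y (sym z₂≡y))

mainTheorem6 : (m n : ℕ) → 1 ≤ m → 1 ≤ n →
    (ω ω′ : Permutation′ n) → IsStable m n ω → IsStable m n ω′ →
    ((α : Fin n) → PS m n ω α ≡ PS m n ω′ α) →
    (x : Fin n) → ω ⟨$⟩ʳ x ≡ ω′ ⟨$⟩ʳ x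
mainTheorem6 (suc _) n _ _ ω ω′ stable stable′ samePS x =
  ⟨$⟩ˡ-agree⇒⟨$⟩ʳ-agree ω ω′ x (inverses-agree (ω′ ⟨$⟩ʳ x))
  where
  inverses-agree : ∀ α → ω ⟨$⟩ˡ α ≡ ω′ ⟨$⟩ˡ α
  inverses-agree = WF.All.wfRec <-wellFounded _ (λ α → ω ⟨$⟩ˡ α ≡ ω′ ⟨$⟩ˡ α) step
    where
    step : ∀ α → (∀ {β} → toℕ β < toℕ α → ω ⟨$⟩ˡ β ≡ ω′ ⟨$⟩ˡ β) → ω ⟨$⟩ˡ α ≡ ω′ ⟨$⟩ˡ α
    step α below with <-cmp (toℕ (ω ⟨$⟩ˡ α)) (toℕ (ω′ ⟨$⟩ˡ α))
    ... | tri< y<y′ _ _ = contradiction (samePS α) (<⇒≢ (position<⇒PS< ω ω′ α stable′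
            (λ z → ⟨$⟩ˡ-agree⇒⟨$⟩ʳ-agree ω ω′ z ∘ below) y<y′))
    ... | tri≈ _ y≡y′ _ = toℕ-injective y≡y′
    ... | tri> _ _ y′<y = contradiction (samePS α) (>⇒≢ (position<⇒PS< ω′ ω α stable
            (λ z → ⟨$⟩ˡ-agree⇒⟨$⟩ʳ-agree ω′ ω z ∘ sym ∘ below) y′<y))
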